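{- Let $\Gamma$ be a finite, simple, connected, undirected graph of valency $k\ge2$ and $G\le\mathrm{Aut}(\Gamma)$ such that $\Gamma$ is $(G,2)$-distance-transitive. Suppose $\gcd(c_2,k-1)=1$. Then either $\Gamma$ has girth $3$ or $\Gamma$ is $(G,2)$-arc-transitive.
   Context: $\Gamma$ is $(G,2)$-distance-transitive if it has diameter at least $2$, $G$ is vertex-transitive, and each $G_u$ is transitive on the vertices at distance $1$ and at distance $2$ from $u$. $c_2$ is the number of common neighbours of two vertices at distance $2$ (constant in this setting). A $2$-arc is a sequence $(u_0,u_1,u_2)$ with $u_0\sim u_1\sim u_2$, $u_0\ne u_2$; $\Gamma$ is $(G,2)$-arc-transitive if $G$ is transitive on vertices and on $2$-arcs. -}

module Defs where

open import Data.Nat using (ℕ; zero; suc; _≤_)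
open import Data.Bool using (Bool; true; false; _∧_)
open import Data.Fin using (Fin)
open import Data.List using (length; filterᵇ; allFin)
open import Data.Product using (Σ; _×_; ∃; ∃-syntax)
open import Relation.Binary.PropositionalEquality using (_≡_; _≢_)
open import Relation.Nullary using (¬_)
open import Function using (id; _∘_)

record Graph (n : ℕ) : Set where
  field
    adj   : Fin n → Fin n → Bool
    sym   : ∀ u v → adj u v ≡ adj v u
    irrefl : ∀ u → adj u u ≡ false

module _ {n : ℕ} (Γ : Graph n) where
  open Graph Γ

  _∼_ : Fin n → Fin n → Set
  u ∼ v = adj u v ≡ true

  data Walk : Fin n → Fin n → ℕ → Set where
    here : ∀ {u} → Walk u u zero
    step : ∀ {u v w m} → u ∼ v → Walk v w m → Walk u w (suc m)

  Dist : Fin n → Fin n → ℕ → Set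
  Dist u v d = Walk u v d × (∀ m → Walk u v m → d ≤ m)

  Connected : Set
  Connected = ∀ u v → ∃[ m ] Walk u v m

  neighbours : Fin n → _
  neighbours u = filterᵇ (adj u) (allFin n)

  Regular : ℕ → Set
  Regular k = ∀ u → length (neighbours u) ≡ k

  commonNbrs : Fin n → Fin n → ℕ
  commonNbrs u v = length (filterᵇ (λ w → adj u w ∧ adj v w) (allFin n))

  DiamGe2 : Set
  DiamGe2 = ∃[ u ] ∃[ v ] ∃[ d ] (2 ≤ d × Dist u v d)

  Girth3 : Set
  Girth3 = ∃[ u ] ∃[ v ] ∃[ w ] (u ∼ v × v ∼ w × w ∼ u)

  record AutGroup : Set₁ where
    field
      Mem    : (Fin n → Fin n) → Set
      resp   : ∀ {f g} → (∀ x → f x ≡ g x) → Mem f → Mem g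
      isAut  : ∀ {f} → Mem f → ∀ u v → adj (f u) (f v) ≡ adj u v
      idMem  : Mem id
      compMem : ∀ {f g} → Mem f → Mem g → Mem (f ∘ g)
      invMem : ∀ {f} → Mem f →
               Σ (Fin n → Fin n) λ g → Mem g × (∀ x → g (f x) ≡ x) × (∀ x → f (g x) ≡ x)

  module _ (G : AutGroup) where
    open AutGroup G

    VertexTransitive : Set
    VertexTransitive = ∀ u v → Σ (Fin n → Fin n) λ g → Mem g × g u ≡ v

    DistTrans2 : Set
    DistTrans2 =
      DiamGe2 × VertexTransitive ×
      (∀ u v w → Dist u v 1 → Dist u w 1 →
         Σ (Fin n → Fin n) λ g → Mem g × g u ≡ u × g v ≡ w) ×
      (∀ u v w → Dist u v 2 → Dist u w 2 →
         Σ (Fin n → Fin n) λ g → Mem g × g u ≡ u × g v ≡ w)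

    TwoArc : Fin n → Fin n → Fin n → Set
    TwoArc u₀ u₁ u₂ = u₀ ∼ u₁ × u₁ ∼ u₂ × u₀ ≢ u₂

    ArcTrans2 : Set
    ArcTrans2 =
      VertexTransitive ×
      (∀ u₀ u₁ u₂ v₀ v₁ v₂ → TwoArc u₀ u₁ u₂ → TwoArc v₀ v₁ v₂ →
         Σ (Fin n → Fin n) λ g → Mem g × g u₀ ≡ v₀ × g u₁ ≡ v₁ × g u₂ ≡ v₂)

{-# OPTIONS --safe #-}
module Submission where

open import Defs hiding (_∼_; TwoArc)
open import Data.Bool using (true; false; if_then_else_; T; _∧_)
open import Data.Bool.Properties using (T-≡; T-∧) renaming (_≟_ to _≟ᵇ_)
open import Data.Fin using (Fin; zero; suc)
open import Data.Fin.Permutation using (Permutation′; permutation; _⟨$⟩ʳ_)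
open import Data.Fin.Properties using (_≟_; any?)
open import Data.List using (List; length; filter; allFin; tabulate; cartesianProduct; map; _++_)
open import Data.List.Membership.Propositional using (_∈_; lose)
open import Data.List.Membership.Propositional.Properties
  using (∈-filter⁺; ∈-filter⁻; ∈-allFin; ∈-cartesianProduct⁺; ∈-map⁺; ∈-++⁺ˡ; ∈-++⁺ʳ)
open import Data.List.Properties using (filter-none; length-filter)
open import Data.List.Relation.Binary.Pointwise using (Pointwise-≡⇒≡)
import Data.List.Relation.Binary.Sublist.Propositional as Sublist
open import Data.List.Relation.Binary.Sublist.Propositional.Properties using (filter⁺; length-mono-≤; to-≋)
import Data.List.Relation.Unary.All as All
open import Data.List.Relation.Unary.Any as Any using (Any)
open import Data.Nat using (ℕ; zero; suc; _+_; _*_; _∸_; _≤_; _<_; _≤?_; z≤n; s≤s; NonZero; >-nonZero)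
open import Data.Nat.Coprimality using (Coprime; coprime-divisor; gcd≡1⇒coprime) renaming (sym to coprime-sym)
open import Data.Nat.Divisibility using (_∣_; divides; ∣⇒≤)
open import Data.Nat.GCD using (gcd)
open import Data.Nat.Properties
  using (module ≤-Reasoning; ≤-antisym; ≤-trans; ≤-reflexive; ≰⇒>; <⇒≱; m≤m+n; +-suc; +-monoʳ-≤;
         +-identityʳ; *-assoc; *-comm; *-cancelˡ-≡; +-*-semiring)
open import Algebra.Properties.Semiring.Sum +-*-semiring
  using (sum; ∑-comm; ∑-distrib-+; sum-permute; sum-cong-≗; sum-replicate-zero; *-distribʳ-sum)
open import Data.Product using (Σ-syntax; ∃; ∃-syntax; _×_; _,_; proj₁; proj₂)
open import Data.Product.Properties using (≡-dec)
open import Data.Sum using (_⊎_; inj₁; inj₂)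
open import Function using (id; _∘_; _⇔_; mk⇔; Equivalence)
open import Level using (0ℓ)
open import Relation.Binary.Definitions using (DecidableEquality)
open import Relation.Binary.PropositionalEquality
  using (_≡_; _≢_; refl; sym; trans; cong; cong₂; subst; subst₂; module ≡-Reasoning)
open import Relation.Nullary using (¬_; Dec; yes; no; does; map′; _×-dec_; _⊎-dec_; ¬?; contradiction)
open import Relation.Nullary.Decidable using (T?)
open import Relation.Unary using (Pred; Decidable; _⊆_)
open import Relation.Unary.Properties using (_∩?_; ∁?)

-- Fix a vertex u, assume Γ has no triangle, and fix a 2-arc (u, v₀, w₀). Let X be the set of pairs
-- (v, w) that the stabiliser G_u maps to (v₀, w₀); every pair in X is a 2-arc (u, v, w), so w lies
-- in the second sphere Γ₂(u). As G_u is transitive on Γ(u) and on Γ₂(u), all rows of X (v ∈ Γ(u))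
-- have the same size b and all columns (w ∈ Γ₂(u)) the same size a. Double counting X and the set
-- of all 2-arcs from u gives k b = |Γ₂(u)| a and k (k - 1) = |Γ₂(u)| c₂, hence b c₂ = (k - 1) a,
-- and coprimality gives (k - 1) ∣ b. Since 0 < b ≤ k - 1, b = k - 1: X contains every 2-arc from u,
-- so G_u is transitive on the 2-arcs starting at u, and vertex-transitivity does the rest.

module _ {A : Set} {P Q : Pred A 0ℓ} (P? : Decidable P) (Q? : Decidable Q) (P⊆Q : P ⊆ Q) where

  filter-sublist : ∀ xs → filter P? xs Sublist.⊆ filter Q? xs
  filter-sublist xs = filter⁺ P? Q? (λ { refl → P⊆Q }) (Sublist.⊆-reflexive {x = xs} refl)

  length-filter-mono : ∀ xs → length (filter P? xs) ≤ length (filter Q? xs)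
  length-filter-mono xs = length-mono-≤ (filter-sublist xs)

  length-filter-≡⇒⊇ : ∀ {xs} → length (filter P? xs) ≡ length (filter Q? xs) → ∀ {x} → x ∈ xs → Q x → P x
  length-filter-≡⇒⊇ {xs} same-length x∈xs qx =
    proj₂ (∈-filter⁻ P? {xs = xs} (subst (_ ∈_) (sym filters-equal) (∈-filter⁺ Q? x∈xs qx)))
    where
      filters-equal : filter P? xs ≡ filter Q? xs
      filters-equal = Pointwise-≡⇒≡ (to-≋ {as = filter P? xs} same-length (filter-sublist xs))

indicator : {A : Set} → Dec A → ℕ
indicator a? = if does a? then 1 else 0

length-filter-tabulate : ∀ {n} {A : Set} {P : Pred A 0ℓ} (P? : Decidable P) (f : Fin n → A) →
                         length (filter P? (tabulate f)) ≡ sum (λ i → indicator (P? (f i)))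
length-filter-tabulate {zero}  P? f = refl
length-filter-tabulate {suc n} P? f with does (P? (f zero))
... | true  = cong suc (length-filter-tabulate P? (f ∘ suc))
... | false = length-filter-tabulate P? (f ∘ suc)

count : ∀ {n} {P : Pred (Fin n) 0ℓ} → Decidable P → ℕ
count {n} P? = length (filter P? (allFin n))

count-as-sum : ∀ {n} {P : Pred (Fin n) 0ℓ} (P? : Decidable P) → count P? ≡ sum (indicator ∘ P?)
count-as-sum P? = length-filter-tabulate P? id

module _ {n} {P : Pred (Fin n) 0ℓ} (P? : Decidable P) where

  count-none : (∀ {x} → ¬ P x) → count P? ≡ 0
  count-none ¬P = cong length (filter-none P? {xs = allFin n} (All.tabulate (λ _ → ¬P)))

  count-permute : (π : Permutation′ n) → count P? ≡ count (P? ∘ (π ⟨$⟩ʳ_))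
  count-permute π = trans (count-as-sum P?) (trans (sum-permute _ π) (sym (count-as-sum (P? ∘ (π ⟨$⟩ʳ_)))))

  sum-≡-count-* : ∀ {b} (f : Fin n → ℕ) → (∀ {i} → P i → f i ≡ b) → (∀ {i} → ¬ P i → f i ≡ 0) →
                  sum f ≡ count P? * b
  sum-≡-count-* {b} f on off = begin
    sum f                             ≡⟨ sum-cong-≗ pointwise ⟩
    sum (λ i → indicator (P? i) * b)  ≡⟨ *-distribʳ-sum b (indicator ∘ P?) ⟨
    sum (indicator ∘ P?) * b          ≡⟨ cong (_* b) (count-as-sum P?) ⟨
    count P? * b                      ∎
    where
      open ≡-Reasoning
      pointwise : ∀ i → f i ≡ indicator (P? i) * b
      pointwise i with P? i
      ... | yes p = trans (on p) (sym (+-identityʳ b))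
      ... | no ¬p = off ¬p

  module _ {Q : Pred (Fin n) 0ℓ} (Q? : Decidable Q) where

    count-mono : P ⊆ Q → count P? ≤ count Q?
    count-mono P⊆Q = length-filter-mono P? Q? P⊆Q (allFin n)

    count-≡⇒⊇ : P ⊆ Q → count P? ≡ count Q? → Q ⊆ P
    count-≡⇒⊇ P⊆Q same-count = length-filter-≡⇒⊇ P? Q? P⊆Q same-count (∈-allFin _)

    count-cong : (∀ {x} → P x ⇔ Q x) → count P? ≡ count Q?
    count-cong P⇔Q = ≤-antisym (count-mono (Equivalence.to P⇔Q))
                               (length-filter-mono Q? P? (Equivalence.from P⇔Q) (allFin n))

    count-split : count P? ≡ count (P? ∩? Q?) + count (P? ∩? ∁? Q?)
    count-split = begin
      count P?                                                            ≡⟨ count-as-sum P? ⟩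
      sum (indicator ∘ P?)                                                ≡⟨ sum-cong-≗ pointwise ⟩
      sum (λ i → indicator ((P? ∩? Q?) i) + indicator ((P? ∩? ∁? Q?) i))
        ≡⟨ ∑-distrib-+ (indicator ∘ (P? ∩? Q?)) (indicator ∘ (P? ∩? ∁? Q?)) ⟩
      sum (indicator ∘ (P? ∩? Q?)) + sum (indicator ∘ (P? ∩? ∁? Q?))
        ≡⟨ cong₂ _+_ (count-as-sum (P? ∩? Q?)) (count-as-sum (P? ∩? ∁? Q?)) ⟨
      count (P? ∩? Q?) + count (P? ∩? ∁? Q?)                              ∎
      where
        open ≡-Reasoning
        pointwise : ∀ i → indicator (P? i) ≡ indicator ((P? ∩? Q?) i) + indicator ((P? ∩? ∁? Q?) i)
        pointwise i with P? i | Q? i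
        ... | yes _ | yes _ = refl
        ... | yes _ | no _  = refl
        ... | no _  | _     = refl

sum-indicator-≟ : ∀ {n} (x : Fin n) → sum (λ i → indicator (x ≟ i)) ≡ 1
sum-indicator-≟ {suc n} zero    = cong suc (sum-replicate-zero n)
sum-indicator-≟ {suc n} (suc x) = sum-indicator-≟ x

count-singleton : ∀ {n} (x : Fin n) → count (x ≟_) ≡ 1
count-singleton x = trans (count-as-sum (x ≟_)) (sum-indicator-≟ x)

double-counting : ∀ {m n} {R : Fin m → Pred (Fin n) 0ℓ} {S : Pred (Fin m) 0ℓ} {T : Pred (Fin n) 0ℓ}
  (R? : ∀ v → Decidable (R v)) (S? : Decidable S) (T? : Decidable T) {b a : ℕ} →
  (∀ {v w} → R v w → S v × T w) →
  (∀ {v} → S v → count (R? v) ≡ b) →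
  (∀ {w} → T w → count (λ v → R? v w) ≡ a) →
  count S? * b ≡ count T? * a
double-counting R? S? T? {b} {a} support rows columns = begin
  count S? * b
    ≡⟨ sum-≡-count-* S? _ rows (λ ¬s → count-none (R? _) (¬s ∘ proj₁ ∘ support)) ⟨
  sum (λ v → count (R? v))                    ≡⟨ sum-cong-≗ (λ v → count-as-sum (R? v)) ⟩
  sum (λ v → sum (λ w → indicator (R? v w)))  ≡⟨ ∑-comm (λ v w → indicator (R? v w)) ⟩
  sum (λ w → sum (λ v → indicator (R? v w)))  ≡⟨ sum-cong-≗ (λ w → count-as-sum (λ v → R? v w)) ⟨
  sum (λ w → count (λ v → R? v w))
    ≡⟨ sum-≡-count-* T? _ columns (λ ¬t → count-none (λ v → R? v _) (¬t ∘ proj₂ ∘ support)) ⟩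
  count T? * a                                ∎
  where open ≡-Reasoning

double-counts⇒∣ : ∀ {k b a K c N} .{{_ : NonZero k}} →
                  k * b ≡ N * a → k * K ≡ N * c → Coprime c K → K ∣ b
double-counts⇒∣ {k} {b} {a} {K} {c} {N} kb≡Na kK≡Nc coprime =
  coprime-divisor (coprime-sym coprime) (divides a (trans (*-comm c b) bc≡aK))
  where
    open ≡-Reasoning
    bc≡aK : b * c ≡ a * K
    bc≡aK = *-cancelˡ-≡ (b * c) (a * K) k (begin
      k * (b * c)  ≡⟨ *-assoc k b c ⟨
      k * b * c    ≡⟨ cong (_* c) kb≡Na ⟩
      N * a * c    ≡⟨ cong (_* c) (*-comm N a) ⟩
      a * N * c    ≡⟨ *-assoc a N c ⟩
      a * (N * c)  ≡⟨ cong (a *_) kK≡Nc ⟨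
      a * (k * K)  ≡⟨ *-comm a (k * K) ⟩
      k * K * a    ≡⟨ *-assoc k K a ⟩
      k * (K * a)  ≡⟨ cong (k *_) (*-comm K a) ⟩
      k * (a * K)  ∎)

-- `Reaches` is decided by saturation: `ReachesWithin j` grows with j, its size is bounded by
-- `length elements`, and once it stops growing it is closed under every `act i`, hence contains
-- all of `Reaches`.
module BackwardOrbit {A I : Set} (_≟ᴬ_ : DecidableEquality A)
  (elements : List A) (elements-complete : ∀ x → x ∈ elements)
  (indices : List I) (indices-complete : ∀ i → i ∈ indices)
  (act : I → A → A) (target : A) where

  data Reaches : A → Set where
    done : Reaches target
    via  : ∀ i {x} → Reaches (act i x) → Reaches x

  ReachesWithin : ℕ → A → Set
  ReachesWithin zero    x = x ≡ target
  ReachesWithin (suc j) x = ReachesWithin j x ⊎ Any (λ i → ReachesWithin j (act i x)) indices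

  reachesWithin? : ∀ j → Decidable (ReachesWithin j)
  reachesWithin? zero    x = x ≟ᴬ target
  reachesWithin? (suc j) x = reachesWithin? j x ⊎-dec Any.any? (λ i → reachesWithin? j (act i x)) indices

  reachesWithin⇒reaches : ∀ j → ReachesWithin j ⊆ Reaches
  reachesWithin⇒reaches zero    refl     = done
  reachesWithin⇒reaches (suc j) (inj₁ r) = reachesWithin⇒reaches j r
  reachesWithin⇒reaches (suc j) (inj₂ r) with Any.satisfied r
  ... | i , rᵢ = via i (reachesWithin⇒reaches j rᵢ)

  target-reachesWithin : ∀ j → ReachesWithin j target
  target-reachesWithin zero    = refl
  target-reachesWithin (suc j) = inj₁ (target-reachesWithin j)

  Stable : ℕ → Set
  Stable j = ReachesWithin (suc j) ⊆ ReachesWithin j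

  stable⇒complete : ∀ {j} → Stable j → Reaches ⊆ ReachesWithin j
  stable⇒complete {j} stable done      = target-reachesWithin j
  stable⇒complete     stable (via i r) = stable (inj₂ (lose (indices-complete i) (stable⇒complete stable r)))

  size : ℕ → ℕ
  size j = length (filter (reachesWithin? j) elements)

  stable-or-grows : ∀ j → Stable j ⊎ size j < size (suc j)
  stable-or-grows j with size (suc j) ≤? size j
  ... | yes no-growth = inj₁ λ {x} → length-filter-≡⇒⊇ (reachesWithin? j) (reachesWithin? (suc j)) inj₁
          (≤-antisym (length-filter-mono (reachesWithin? j) (reachesWithin? (suc j)) inj₁ elements) no-growth)
          (elements-complete x)
  ... | no growth = inj₂ (≰⇒> growth)

  stabilises : ∀ fuel j → length elements ≤ fuel + size j → ∃ Stable
  stabilises fuel j bound with stable-or-grows j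
  ... | inj₁ stable = j , stable
  stabilises zero       j bound | inj₂ grows =
    contradiction (≤-trans (length-filter (reachesWithin? (suc j)) elements) bound) (<⇒≱ grows)
  stabilises (suc fuel) j bound | inj₂ grows = stabilises fuel (suc j) (begin
    length elements      ≤⟨ bound ⟩
    suc fuel + size j    ≡⟨ +-suc fuel (size j) ⟨
    fuel + suc (size j)  ≤⟨ +-monoʳ-≤ fuel grows ⟩
    fuel + size (suc j)  ∎)
    where open ≤-Reasoning

  reaches? : Decidable Reaches
  reaches? x with stabilises (length elements) zero (m≤m+n _ _)
  ... | j , stable = map′ (reachesWithin⇒reaches j) (stable⇒complete stable) (reachesWithin? j x)

module _ {n} (Γ : Graph n) where
  open Graph Γ renaming (sym to adj-sym)

  infix 4 _∼_ _∼?_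

  _∼_ : Fin n → Fin n → Set
  _∼_ = Defs._∼_ Γ

  _∼?_ : ∀ u v → Dec (u ∼ v)
  u ∼? v = adj u v ≟ᵇ true

  ∼-sym : ∀ {u v} → u ∼ v → v ∼ u
  ∼-sym {u} {v} u∼v = trans (adj-sym v u) u∼v

  ∼⇒≢ : ∀ {u v} → u ∼ v → u ≢ v
  ∼⇒≢ {u} u∼u refl with () ← trans (sym (irrefl u)) u∼u

  walk-length-≥1 : ∀ {u v} → u ≢ v → ∀ m → Walk Γ u v m → 1 ≤ m
  walk-length-≥1 u≢u zero    here = contradiction refl u≢u
  walk-length-≥1 _   (suc m) _    = s≤s z≤n

  walk-length-≥2 : ∀ {u w} → u ≢ w → ¬ u ∼ w → ∀ m → Walk Γ u w m → 2 ≤ m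
  walk-length-≥2 u≢u _   zero          here            = contradiction refl u≢u
  walk-length-≥2 _   u≁w (suc zero)    (step u∼w here) = contradiction u∼w u≁w
  walk-length-≥2 _   _   (suc (suc m)) _               = s≤s (s≤s z≤n)

  ∼⇒Dist₁ : ∀ {u v} → u ∼ v → Dist Γ u v 1
  ∼⇒Dist₁ u∼v = step u∼v here , walk-length-≥1 (∼⇒≢ u∼v)

  -- A decidable stand-in for `Dist Γ u w 2`, which quantifies over all walks.
  AtDistance₂ : Fin n → Fin n → Set
  AtDistance₂ u w = ¬ u ∼ w × u ≢ w × ∃[ v ] (u ∼ v × v ∼ w)

  atDistance₂? : ∀ u w → Dec (AtDistance₂ u w)
  atDistance₂? u w = ¬? (u ∼? w) ×-dec ¬? (u ≟ w) ×-dec any? (λ v → u ∼? v ×-dec v ∼? w)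

  atDistance₂⇒Dist : ∀ {u w} → AtDistance₂ u w → Dist Γ u w 2
  atDistance₂⇒Dist (u≁w , u≢w , v , u∼v , v∼w) = step u∼v (step v∼w here) , walk-length-≥2 u≢w u≁w

  girth3? : Dec (Girth3 Γ)
  girth3? = any? λ u → any? λ v → any? λ w → u ∼? v ×-dec v ∼? w ×-dec w ∼? u

  degree : ∀ {k} → Regular Γ k → ∀ u → count (u ∼?_) ≡ k
  degree regular u = trans (sym (count-cong (T? ∘ adj u) (u ∼?_) T-≡)) (regular u)

  module _ (G : AutGroup Γ) where
    open AutGroup G

    TwoArc : Fin n → Fin n → Fin n → Set
    TwoArc = Defs.TwoArc Γ G

    twoArc? : ∀ u v w → Dec (TwoArc u v w)
    twoArc? u v w = u ∼? v ×-dec v ∼? w ×-dec ¬? (u ≟ w)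

    twoArc⇒atDistance₂ : ¬ Girth3 Γ → ∀ {u v w} → TwoArc u v w → AtDistance₂ u w
    twoArc⇒atDistance₂ triangle-free {u} {v} {w} (u∼v , v∼w , u≢w) =
      (λ u∼w → triangle-free (u , v , w , u∼v , v∼w , ∼-sym u∼w)) , u≢w , v , u∼v , v∼w

    twoArcs-through : ∀ {k} → Regular Γ k → ∀ {u v} → u ∼ v → k ≡ suc (count (twoArc? u v))
    twoArcs-through {k} regular {u} {v} u∼v = begin
      k                                                                         ≡⟨ degree regular v ⟨
      count (v ∼?_)                                                             ≡⟨ count-split (v ∼?_) (u ≟_) ⟩
      count (λ w → v ∼? w ×-dec u ≟ w) + count (λ w → v ∼? w ×-dec ¬? (u ≟ w))
        ≡⟨ cong₂ _+_ back-to-u onwards ⟩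
      suc (count (twoArc? u v))                                                 ∎
      where
        open ≡-Reasoning
        back-to-u : count (λ w → v ∼? w ×-dec u ≟ w) ≡ 1
        back-to-u = trans (count-cong _ (u ≟_) (mk⇔ proj₂ λ { refl → ∼-sym u∼v , refl })) (count-singleton u)
        onwards : count (λ w → v ∼? w ×-dec ¬? (u ≟ w)) ≡ count (twoArc? u v)
        onwards = count-cong _ (twoArc? u v) (mk⇔ (λ (v∼w , u≢w) → u∼v , v∼w , u≢w) proj₂)

    twoArcs-into : ∀ {u w} → u ≢ w → count (λ v → twoArc? u v w) ≡ commonNbrs Γ u w
    twoArcs-into {u} {w} u≢w = count-cong _ (T? ∘ λ v → adj u v ∧ adj w v) (mk⇔ to from)
      where
        to : ∀ {v} → TwoArc u v w → T (adj u v ∧ adj w v)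
        to (u∼v , v∼w , _) = Equivalence.from T-∧ (Equivalence.from T-≡ u∼v , Equivalence.from T-≡ (∼-sym v∼w))
        from : ∀ {v} → T (adj u v ∧ adj w v) → TwoArc u v w
        from uv∧wv with Equivalence.to T-∧ uv∧wv
        ... | uv , wv = Equivalence.to T-≡ uv , ∼-sym (Equivalence.to T-≡ wv) , u≢w

    mem-injective : ∀ {g} → Mem g → ∀ {x y} → g x ≡ g y → x ≡ y
    mem-injective g∈G {x} {y} gx≡gy with invMem g∈G
    ... | h , _ , hg≡id , _ = trans (sym (hg≡id x)) (trans (cong h gx≡gy) (hg≡id y))

    toPermutation : ∀ {g} → Mem g → Permutation′ n
    toPermutation {g} g∈G with invMem g∈G
    ... | h , _ , hg≡id , gh≡id = permutation g h gh≡id hg≡id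

    twoArc-image : ∀ {g} → Mem g → ∀ {u v w} → TwoArc u v w → TwoArc (g u) (g v) (g w)
    twoArc-image g∈G {u} {v} {w} (u∼v , v∼w , u≢w) =
      trans (isAut g∈G u v) u∼v , trans (isAut g∈G v w) v∼w , u≢w ∘ mem-injective g∈G

    twoArc-preimage : ∀ {g} → Mem g → ∀ {u v w} → TwoArc (g u) (g v) (g w) → TwoArc u v w
    twoArc-preimage g∈G {u} {v} {w} (u∼v , v∼w , u≢w) =
      trans (sym (isAut g∈G u v)) u∼v , trans (sym (isAut g∈G v w)) v∼w , u≢w ∘ cong _

    StabiliserTransitiveOn : Fin n → Pred (Fin n) 0ℓ → Set
    StabiliserTransitiveOn u S = ∀ {x y} → S x → S y → Σ[ g ∈ (Fin n → Fin n) ] Mem g × g u ≡ u × g x ≡ y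

    LocallyTwoArcTransitive : Fin n → Set
    LocallyTwoArcTransitive u = ∀ {v w v′ w′} → TwoArc u v w → TwoArc u v′ w′ →
                                Σ[ g ∈ (Fin n → Fin n) ] Mem g × g u ≡ u × g v ≡ v′ × g w ≡ w′

    twoArcTransitive : VertexTransitive Γ G → (∀ u → LocallyTwoArcTransitive u) → ArcTrans2 Γ G
    twoArcTransitive vertexTransitive local = vertexTransitive , transitive
      where
        transitive : ∀ u₀ u₁ u₂ v₀ v₁ v₂ → TwoArc u₀ u₁ u₂ → TwoArc v₀ v₁ v₂ →
                     Σ[ g ∈ (Fin n → Fin n) ] Mem g × g u₀ ≡ v₀ × g u₁ ≡ v₁ × g u₂ ≡ v₂
        transitive u₀ u₁ u₂ v₀ v₁ v₂ arc arc′ with vertexTransitive u₀ v₀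
        ... | h , h∈G , refl with local (h u₀) (twoArc-image h∈G arc) arc′
        ...   | g , g∈G , gv₀ , gu₁ , gu₂ = g ∘ h , compMem g∈G h∈G , gv₀ , gu₁ , gu₂

    transporter : ∀ {u} {S : Pred (Fin n) 0ℓ} → Decidable S → StabiliserTransitiveOn u S → ∀ x y →
                  Σ[ g ∈ (Fin n → Fin n) ] Mem g × g u ≡ u × (S x → S y → g x ≡ y)
    transporter S? transitive x y with S? x | S? y
    ... | yes sx | yes sy = let g , g∈G , gu , gx = transitive sx sy in g , g∈G , gu , λ _ _ → gx
    ... | yes _  | no ¬sy = id , idMem , refl , λ _ sy → contradiction sy ¬sy
    ... | no ¬sx | _      = id , idMem , refl , λ sx → contradiction sx ¬sx

    -- `Mem` is not decidable, so instead of the G_u-orbit of (v₀, w₀) we use its orbit under finitely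
    -- many elements of G_u: one sending x to y for each pair of neighbours of u (inj₁) and for each
    -- pair of vertices at distance 2 from u (inj₂). This orbit may be smaller, but the row and column
    -- counts only need its invariance under these elements.
    module TwoArcOrbit {u : Fin n}
      (transitive₁ : StabiliserTransitiveOn u (u ∼_))
      (transitive₂ : StabiliserTransitiveOn u (AtDistance₂ u))
      (v₀ w₀ : Fin n) where

      Generator : Set
      Generator = (Fin n × Fin n) ⊎ (Fin n × Fin n)

      generator : Generator → Fin n → Fin n
      generator (inj₁ (x , y)) = proj₁ (transporter (u ∼?_) transitive₁ x y)
      generator (inj₂ (x , y)) = proj₁ (transporter (atDistance₂? u) transitive₂ x y)

      generator-fixes : ∀ i → Mem (generator i) × generator i u ≡ u
      generator-fixes (inj₁ (x , y)) = let _ , g∈G , gu , _ = transporter (u ∼?_) transitive₁ x y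
                                       in g∈G , gu
      generator-fixes (inj₂ (x , y)) = let _ , g∈G , gu , _ = transporter (atDistance₂? u) transitive₂ x y
                                       in g∈G , gu

      generator₁-sends : ∀ {x y} → u ∼ x → u ∼ y → generator (inj₁ (x , y)) x ≡ y
      generator₁-sends {x} {y} = proj₂ (proj₂ (proj₂ (transporter (u ∼?_) transitive₁ x y)))

      generator₂-sends : ∀ {x y} → AtDistance₂ u x → AtDistance₂ u y → generator (inj₂ (x , y)) x ≡ y
      generator₂-sends {x} {y} = proj₂ (proj₂ (proj₂ (transporter (atDistance₂? u) transitive₂ x y)))

      pairs : List (Fin n × Fin n)
      pairs = cartesianProduct (allFin n) (allFin n)

      pairs-complete : ∀ p → p ∈ pairs
      pairs-complete (x , y) = ∈-cartesianProduct⁺ (∈-allFin x) (∈-allFin y)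

      generators : List Generator
      generators = map inj₁ pairs ++ map inj₂ pairs

      generators-complete : ∀ i → i ∈ generators
      generators-complete (inj₁ p) = ∈-++⁺ˡ (∈-map⁺ inj₁ (pairs-complete p))
      generators-complete (inj₂ p) = ∈-++⁺ʳ (map inj₁ pairs) (∈-map⁺ inj₂ (pairs-complete p))

      act : Generator → Fin n × Fin n → Fin n × Fin n
      act i (v , w) = generator i v , generator i w

      open BackwardOrbit (≡-dec _≟_ _≟_) pairs pairs-complete generators generators-complete act (v₀ , w₀)

      InOrbit : Fin n → Fin n → Set
      InOrbit v w = Reaches (v , w)

      inOrbit? : ∀ v w → Dec (InOrbit v w)
      inOrbit? v w = reaches? (v , w)

      reaches⇒mapped : ∀ {p} → Reaches p →
                       Σ[ g ∈ (Fin n → Fin n) ] Mem g × g u ≡ u × g (proj₁ p) ≡ v₀ × g (proj₂ p) ≡ w₀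
      reaches⇒mapped done      = id , idMem , refl , refl , refl
      reaches⇒mapped (via i r) with reaches⇒mapped r | generator-fixes i
      ... | g , g∈G , gu , gv , gw | h∈G , hu =
        g ∘ generator i , compMem g∈G h∈G , trans (cong g hu) gu , gv , gw

      row-≤ : ∀ {v v′} → u ∼ v → u ∼ v′ → count (inOrbit? v) ≤ count (inOrbit? v′)
      row-≤ {v} {v′} u∼v u∼v′ = begin
        count (inOrbit? v)                     ≡⟨ cong (λ x → count (inOrbit? x)) (generator₁-sends u∼v′ u∼v) ⟨
        count (inOrbit? (g v′))
          ≡⟨ count-permute (inOrbit? (g v′)) (toPermutation (proj₁ (generator-fixes i))) ⟩
        count (λ w → inOrbit? (g v′) (g w))    ≤⟨ count-mono _ (inOrbit? v′) (via i) ⟩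
        count (inOrbit? v′)                    ∎
        where
          open ≤-Reasoning
          i : Generator
          i = inj₁ (v′ , v)
          g : Fin n → Fin n
          g = generator i

      column-≤ : ∀ {w w′} → AtDistance₂ u w → AtDistance₂ u w′ →
                 count (λ v → inOrbit? v w) ≤ count (λ v → inOrbit? v w′)
      column-≤ {w} {w′} d d′ = begin
        count (λ v → inOrbit? v w)             ≡⟨ cong (λ x → count (λ v → inOrbit? v x)) (generator₂-sends d′ d) ⟨
        count (λ v → inOrbit? v (g w′))
          ≡⟨ count-permute (λ v → inOrbit? v (g w′)) (toPermutation (proj₁ (generator-fixes i))) ⟩
        count (λ v → inOrbit? (g v) (g w′))    ≤⟨ count-mono _ (λ v → inOrbit? v w′) (via i) ⟩
        count (λ v → inOrbit? v w′)            ∎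
        where
          open ≤-Reasoning
          i : Generator
          i = inj₂ (w′ , w)
          g : Fin n → Fin n
          g = generator i

      row-constant : ∀ {v v′} → u ∼ v → u ∼ v′ → count (inOrbit? v) ≡ count (inOrbit? v′)
      row-constant u∼v u∼v′ = ≤-antisym (row-≤ u∼v u∼v′) (row-≤ u∼v′ u∼v)

      column-constant : ∀ {w w′} → AtDistance₂ u w → AtDistance₂ u w′ →
                        count (λ v → inOrbit? v w) ≡ count (λ v → inOrbit? v w′)
      column-constant d d′ = ≤-antisym (column-≤ d d′) (column-≤ d′ d)

      module _ {k c₂ : ℕ} (triangle-free : ¬ Girth3 Γ) (regular : Regular Γ k)
        (c₂-common : ∀ {w} → AtDistance₂ u w → commonNbrs Γ u w ≡ c₂)
        (coprime : Coprime c₂ (k ∸ 1)) (arc₀ : TwoArc u v₀ w₀) where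

        inOrbit⇒twoArc : ∀ {v w} → InOrbit v w → TwoArc u v w
        inOrbit⇒twoArc r with reaches⇒mapped r
        ... | g , g∈G , gu , gv , gw =
          twoArc-preimage g∈G (subst (λ x → TwoArc x _ _) (sym gu) (subst₂ (TwoArc u) (sym gv) (sym gw) arc₀))

        twoArc-support : ∀ {v w} → TwoArc u v w → u ∼ v × AtDistance₂ u w
        twoArc-support arc = proj₁ arc , twoArc⇒atDistance₂ triangle-free arc

        twoArcs-per-neighbour : ∀ {v} → u ∼ v → count (twoArc? u v) ≡ k ∸ 1
        twoArcs-per-neighbour u∼v = cong (_∸ 1) (sym (twoArcs-through regular u∼v))

        orbit-double-count : k * count (inOrbit? v₀) ≡ count (atDistance₂? u) * count (λ v → inOrbit? v w₀)
        orbit-double-count = subst (λ d → d * _ ≡ _) (degree regular u)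
          (double-counting inOrbit? (u ∼?_) (atDistance₂? u) (twoArc-support ∘ inOrbit⇒twoArc)
            (λ u∼v → row-constant u∼v (proj₁ arc₀))
            (λ d → column-constant d (twoArc⇒atDistance₂ triangle-free arc₀)))

        twoArc-double-count : k * (k ∸ 1) ≡ count (atDistance₂? u) * c₂
        twoArc-double-count = subst (λ d → d * _ ≡ _) (degree regular u)
          (double-counting (twoArc? u) (u ∼?_) (atDistance₂? u) twoArc-support twoArcs-per-neighbour
            (λ d → trans (twoArcs-into (proj₁ (proj₂ d))) (c₂-common d)))

        orbit-row-full : count (inOrbit? v₀) ≡ k ∸ 1
        orbit-row-full = ≤-antisym row≤k-1 (∣⇒≤ {{>-nonZero row>0}} k-1∣row)
          where
            row≤k-1 : count (inOrbit? v₀) ≤ k ∸ 1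
            row≤k-1 = subst (count (inOrbit? v₀) ≤_) (twoArcs-per-neighbour (proj₁ arc₀))
                            (count-mono (inOrbit? v₀) (twoArc? u v₀) inOrbit⇒twoArc)
            row>0 : 0 < count (inOrbit? v₀)
            row>0 = subst (_≤ count (inOrbit? v₀)) (count-singleton w₀)
                          (count-mono (w₀ ≟_) (inOrbit? v₀) λ { refl → done })
            k>0 : 0 < k
            k>0 = subst (0 <_) (sym (twoArcs-through regular (proj₁ arc₀))) (s≤s z≤n)
            k-1∣row : k ∸ 1 ∣ count (inOrbit? v₀)
            k-1∣row = double-counts⇒∣ {N = count (atDistance₂? u)} {{>-nonZero k>0}}
                        orbit-double-count twoArc-double-count coprime

        twoArc⇒inOrbit : ∀ {v w} → TwoArc u v w → InOrbit v w
        twoArc⇒inOrbit {v} arc = count-≡⇒⊇ (inOrbit? v) (twoArc? u v) inOrbit⇒twoArc same-count arc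
          where
            same-count : count (inOrbit? v) ≡ count (twoArc? u v)
            same-count = begin
              count (inOrbit? v)   ≡⟨ row-constant (proj₁ arc) (proj₁ arc₀) ⟩
              count (inOrbit? v₀)  ≡⟨ orbit-row-full ⟩
              k ∸ 1                ≡⟨ twoArcs-per-neighbour (proj₁ arc) ⟨
              count (twoArc? u v)  ∎
              where open ≡-Reasoning

    locallyTwoArcTransitive : ∀ {k c₂} → ¬ Girth3 Γ → Regular Γ k → ∀ {u} →
      (∀ {w} → AtDistance₂ u w → commonNbrs Γ u w ≡ c₂) → Coprime c₂ (k ∸ 1) →
      StabiliserTransitiveOn u (u ∼_) → StabiliserTransitiveOn u (AtDistance₂ u) →
      LocallyTwoArcTransitive u
    locallyTwoArcTransitive triangle-free regular c₂-common coprime transitive₁ transitive₂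
                            {v′ = v′} {w′} arc arc′ =
      reaches⇒mapped (twoArc⇒inOrbit triangle-free regular c₂-common coprime arc′ arc)
      where open TwoArcOrbit transitive₁ transitive₂ v′ w′

lemma5p6 : (n k c₂ : ℕ) (Γ : Graph n) (G : AutGroup Γ) →
    Connected Γ → Regular Γ k → 2 ≤ k → DistTrans2 Γ G →
    (∀ u v → Dist Γ u v 2 → commonNbrs Γ u v ≡ c₂) →
    gcd c₂ (k ∸ 1) ≡ 1 →
    Girth3 Γ ⊎ ArcTrans2 Γ G
lemma5p6 n k c₂ Γ G _ regular _ (_ , vertexTransitive , transitive₁ , transitive₂) c₂-common gcd≡1
  with girth3? Γ
... | yes triangle      = inj₁ triangle
... | no  triangle-free = inj₂ (twoArcTransitive Γ G vertexTransitive λ u →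
  locallyTwoArcTransitive Γ G triangle-free regular
    (λ d → c₂-common u _ (atDistance₂⇒Dist Γ d)) (gcd≡1⇒coprime gcd≡1)
    (λ s s′ → transitive₁ u _ _ (∼⇒Dist₁ Γ s) (∼⇒Dist₁ Γ s′))
    (λ d d′ → transitive₂ u _ _ (atDistance₂⇒Dist Γ d) (atDistance₂⇒Dist Γ d′)))
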